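{- Let $\mathcal{U}$ be a universe with $\{\cdot\mid 2\}\in\mathcal{U}$. Then $\mathcal{U}$ is weak, and hence reduced.
   Context: Games are short partizan game forms under the misère convention (a player unable to move wins); $0=\{\cdot\mid\cdot\}$, $1=\{0\mid\cdot\}$, $2=\{1\mid\cdot\}$, and $\{\cdot\mid 2\}$ has no Left option and single Right option $2$. $o_L(G)$ (resp. $o_R(G)$) is the winner when Left (resp. Right) moves first; outcome classes ordered $\mathscr{L}>\mathscr{N}>\mathscr{R}$, $\mathscr{L}>\mathscr{P}>\mathscr{R}$. For a set of games $\mathcal{A}$, $G\geq_{\mathcal{A}}H$ iff $o(G+X)\geq o(H+X)$ for all $X\in\mathcal{A}$; $\equiv_{\mathcal{A}}$ means both directions. A universe is a set $\mathcal{U}$ of games closed under sums, conjugates, options, and formation of $\{\mathscr{G}\mid\mathscr{H}\}$ for finite non-empty $\mathscr{G},\mathscr{H}\subseteq\mathcal{U}$. Augmented forms (Siegel): game forms where each subposition may carry a Left and/or Right tombstone (markers, not options); an augmented form is Left end-like if it has no Left options or a Left tombstone (Right end-like symmetrically); a player to move on a position end-like for them wins immediately; $G+H$ carries a Left tombstone iff both are Left end-like and at least one carries one (symmetrically for Right). $G$ is Left $\mathcal{U}$-strong if $o_L(G+X)=\mathscr{L}$ for all Left ends $X\in\mathcal{U}$, Right $\mathcal{U}$-strong if $o_R(G+X)=\mathscr{R}$ for all Right ends $X\in\mathcal{U}$. $\mathcal{U}$ is weak if every augmented form is Left (resp. Right) $\mathcal{U}$-strong exactly when it is Left (resp. Right)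 end-like. $\mathcal{U}$ is reduced if every $G\in\mathcal{U}$ with $G+H\equiv_{\mathcal{U}}0$ for some $H\in\mathcal{U}$ satisfies $G\equiv_{\mathcal{U}}0$. -}

module Defs where

open import Data.Bool using (Bool; true; false; not; _∧_; _∨_; if_then_else_)
open import Data.List using (List; []; _∷_; _++_; [_])
open import Data.List.Membership.Propositional using (_∈_)
open import Data.List.Relation.Unary.All using (All)
open import Data.Product using (Σ; _×_)
open import Data.Sum using (_⊎_)
open import Relation.Binary.PropositionalEquality using (_≡_; _≢_)
open import Function.Bundles using (_⇔_)

data Game : Set where
  ⟨_∣_⟩ : List Game → List Game → Game

leftOpts : Game → List Game
leftOpts ⟨ l ∣ r ⟩ = l

rightOpts : Game → List Game
rightOpts ⟨ l ∣ r ⟩ = r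

zeroG : Game
zeroG = ⟨ [] ∣ [] ⟩

oneG : Game
oneG = ⟨ [ zeroG ] ∣ [] ⟩

twoG : Game
twoG = ⟨ [ oneG ] ∣ [] ⟩

noneBar2 : Game
noneBar2 = ⟨ [] ∣ [ twoG ] ⟩

mutual
  infixl 6 _+_
  _+_ : Game → Game → Game
  ⟨ gl ∣ gr ⟩ + ⟨ hl ∣ hr ⟩ =
    ⟨ addL gl ⟨ hl ∣ hr ⟩ ++ addR ⟨ gl ∣ gr ⟩ hl
    ∣ addL gr ⟨ hl ∣ hr ⟩ ++ addR ⟨ gl ∣ gr ⟩ hr ⟩

  addL : List Game → Game → List Game
  addL [] h = []
  addL (g ∷ gs) h = (g + h) ∷ addL gs h

  addR : Game → List Game → List Game
  addR g [] = []
  addR g (h ∷ hs) = (g + h) ∷ addR g hs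

mutual
  conj : Game → Game
  conj ⟨ l ∣ r ⟩ = ⟨ conjs r ∣ conjs l ⟩

  conjs : List Game → List Game
  conjs [] = []
  conjs (g ∷ gs) = conj g ∷ conjs gs

-- Misère outcomes (a player unable to move wins)

data Player : Set where
  Left Right : Player

mutual
  lWins : Game → Bool
  lWins ⟨ [] ∣ r ⟩ = true
  lWins ⟨ g ∷ gs ∣ r ⟩ = someNotRWins (g ∷ gs)

  rWins : Game → Bool
  rWins ⟨ l ∣ [] ⟩ = true
  rWins ⟨ l ∣ g ∷ gs ⟩ = someNotLWins (g ∷ gs)

  someNotRWins : List Game → Bool
  someNotRWins [] = false
  someNotRWins (g ∷ gs) = not (rWins g) ∨ someNotRWins gs

  someNotLWins : List Game → Bool
  someNotLWins [] = false
  someNotLWins (g ∷ gs) = not (lWins g) ∨ someNotLWins gs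

oL : Game → Player
oL g = if lWins g then Left else Right

oR : Game → Player
oR g = if rWins g then Right else Left

data Outcome : Set where
  𝓛 𝓝 𝓟 𝓡 : Outcome

outcomeOf : Player → Player → Outcome
outcomeOf Left  Left  = 𝓛
outcomeOf Left  Right = 𝓝
outcomeOf Right Left  = 𝓟
outcomeOf Right Right = 𝓡

o : Game → Outcome
o g = outcomeOf (oL g) (oR g)

data _≤O_ : Outcome → Outcome → Set where
  refl≤ : ∀ {x} → x ≤O x
  R≤N : 𝓡 ≤O 𝓝
  R≤P : 𝓡 ≤O 𝓟
  R≤L : 𝓡 ≤O 𝓛
  N≤L : 𝓝 ≤O 𝓛
  P≤L : 𝓟 ≤O 𝓛

_≥[_]_ : Game → (Game → Set) → Game → Set
G ≥[ A ] H = ∀ X → A X → o (H + X) ≤O o (G + X)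

_≡[_]_ : Game → (Game → Set) → Game → Set
G ≡[ A ] H = (G ≥[ A ] H) × (H ≥[ A ] G)

record IsUniverse (U : Game → Set) : Set where
  field
    sum-closed  : ∀ {G H} → U G → U H → U (G + H)
    conj-closed : ∀ {G} → U G → U (conj G)
    leftOpt-closed  : ∀ {gl gr G'} → U ⟨ gl ∣ gr ⟩ → G' ∈ gl → U G'
    rightOpt-closed : ∀ {gl gr G'} → U ⟨ gl ∣ gr ⟩ → G' ∈ gr → U G'
    form-closed : ∀ (gl gr : List Game) → gl ≢ [] → gr ≢ [] →
                  All U gl → All U gr → U ⟨ gl ∣ gr ⟩

-- Augmented forms: each subposition carries a Left and a Right
-- tombstone flag (true = tombstone present).

data AGame : Set where
  node : (leftTomb rightTomb : Bool) → List AGame → List AGame → AGame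

nullB : ∀ {A : Set} → List A → Bool
nullB [] = true
nullB (_ ∷ _) = false

leftEndLikeB : AGame → Bool
leftEndLikeB (node lt rt l r) = nullB l ∨ lt

rightEndLikeB : AGame → Bool
rightEndLikeB (node lt rt l r) = nullB r ∨ rt

aLeftOpts : AGame → List AGame
aLeftOpts (node lt rt l r) = l

aRightOpts : AGame → List AGame
aRightOpts (node lt rt l r) = r

LeftEndLike : AGame → Set
LeftEndLike (node lt rt l r) = (l ≡ []) ⊎ (lt ≡ true)

RightEndLike : AGame → Set
RightEndLike (node lt rt l r) = (r ≡ []) ⊎ (rt ≡ true)

mutual
  infixl 6 _⊕_
  _⊕_ : AGame → AGame → AGame
  node lt rt gl gr ⊕ node lt' rt' hl hr =
    node ((leftEndLikeB (node lt rt gl gr) ∧ leftEndLikeB (node lt' rt' hl hr)) ∧ (lt ∨ lt'))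
         ((rightEndLikeB (node lt rt gl gr) ∧ rightEndLikeB (node lt' rt' hl hr)) ∧ (rt ∨ rt'))
         (addLA gl (node lt' rt' hl hr) ++ addRA (node lt rt gl gr) hl)
         (addLA gr (node lt' rt' hl hr) ++ addRA (node lt rt gl gr) hr)

  addLA : List AGame → AGame → List AGame
  addLA [] h = []
  addLA (g ∷ gs) h = (g ⊕ h) ∷ addLA gs h

  addRA : AGame → List AGame → List AGame
  addRA g [] = []
  addRA g (h ∷ hs) = (g ⊕ h) ∷ addRA g hs

mutual
  ι : Game → AGame
  ι ⟨ l ∣ r ⟩ = node false false (ιs l) (ιs r)

  ιs : List Game → List AGame
  ιs [] = []
  ιs (g ∷ gs) = ι g ∷ ιs gs

-- play on augmented forms: a player to move on a position end-like
-- for them wins immediately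
mutual
  lWinsA : AGame → Bool
  lWinsA (node lt rt [] r) = true
  lWinsA (node lt rt (g ∷ gs) r) = lt ∨ someNotRWinsA (g ∷ gs)

  rWinsA : AGame → Bool
  rWinsA (node lt rt l []) = true
  rWinsA (node lt rt l (g ∷ gs)) = rt ∨ someNotLWinsA (g ∷ gs)

  someNotRWinsA : List AGame → Bool
  someNotRWinsA [] = false
  someNotRWinsA (g ∷ gs) = not (rWinsA g) ∨ someNotRWinsA gs

  someNotLWinsA : List AGame → Bool
  someNotLWinsA [] = false
  someNotLWinsA (g ∷ gs) = not (lWinsA g) ∨ someNotLWinsA gs

oLA : AGame → Player
oLA g = if lWinsA g then Left else Right

oRA : AGame → Player
oRA g = if rWinsA g then Right else Left

LeftEnd : Game → Set
LeftEnd X = leftOpts X ≡ []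

RightEnd : Game → Set
RightEnd X = rightOpts X ≡ []

LeftStrong : (Game → Set) → AGame → Set
LeftStrong U G = ∀ X → U X → LeftEnd X → oLA (G ⊕ ι X) ≡ Left

RightStrong : (Game → Set) → AGame → Set
RightStrong U G = ∀ X → U X → RightEnd X → oRA (G ⊕ ι X) ≡ Right

Weak : (Game → Set) → Set
Weak U = ∀ (G : AGame) → (LeftStrong U G ⇔ LeftEndLike G)
                       × (RightStrong U G ⇔ RightEndLike G)

Reduced : (Game → Set) → Set
Reduced U = ∀ G → U G → Σ Game (λ H → U H × ((G + H) ≡[ U ] zeroG)) → G ≡[ U ] zeroG

{-# OPTIONS --safe #-}
-- Let Y = {·|2} and let G be an augmented form with a Left option but no Left tombstone, of
-- height at most m + 1.  Left, moving first, loses G + m·Y, where m·Y is a Left end of the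
-- universe: while copies of Y remain, Right answers each move by turning one of them into 2,
-- which hands Left two spare moves; afterwards Right plays in G.  Left always has a move and so
-- can never win by running out, while Right runs out as soon as G does; on Right's turn the
-- invariant is  height ≤ (copies of Y left) + (spare Left moves).  So a Left strong form is Left
-- end-like, and conjugation gives the Right half.  For reducedness: if G + H ≡ 0 then G + H is
-- strong, hence end-like, on both sides; carrying no tombstones it has no options, so G = 0.
module Submission where

open import Defs
open import Data.Bool using (Bool; true; false; not; _∧_; _∨_; if_then_else_)
open import Data.Bool.Properties using (∨-zeroʳ; ∧-zeroʳ)
open import Data.Empty using (⊥-elim)
open import Data.List using (List; []; _∷_; _++_; map)
open import Data.List.Properties using (++-conicalʳ)
open import Data.List.Membership.Propositional using (_∈_)
open import Data.List.Membership.Propositional.Properties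
  using (∈-map⁺; ∈-map⁻; ∈-++⁺ˡ; ∈-++⁺ʳ; ∈-++⁻)
open import Data.List.Relation.Unary.Any using (here; there)
open import Data.Nat using (ℕ; zero; suc; _≤_; s≤s; _⊔_) renaming (_+_ to _+ℕ_)
open import Data.Nat.Properties using (≤-trans; n≤1+n; m≤m⊔n; m≤n⊔m; m≤m+n; +-suc; +-monoʳ-≤)
open import Data.Product using (∃-syntax; _×_; _,_; proj₁; proj₂)
open import Data.Sum as Sum using (inj₁; inj₂; [_,_])
open import Function using (_∘_)
open import Function.Bundles using (mk⇔; Equivalence)
open import Relation.Nullary using (¬_; Dec; yes; no; contradiction)
open import Relation.Binary.PropositionalEquality
  using (_≡_; refl; sym; trans; cong; cong₂; subst; module ≡-Reasoning)

private
  variable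
    a b m n : ℕ
    lt rt : Bool
    G H : AGame
    X Z : Game
    U : Game → Set

addR≡map : ∀ g hs → addR g hs ≡ map (g +_) hs
addR≡map g []       = refl
addR≡map g (h ∷ hs) = cong (g + h ∷_) (addR≡map g hs)

∈-addR⁺ : ∀ {g h hs} → h ∈ hs → g + h ∈ addR g hs
∈-addR⁺ {g} {hs = hs} p = subst (_ ∈_) (sym (addR≡map g hs)) (∈-map⁺ (g +_) p)

∈-addR⁻ : ∀ {g x hs} → x ∈ addR g hs → ∃[ h ] h ∈ hs × x ≡ g + h
∈-addR⁻ {g} {hs = hs} p = ∈-map⁻ (g +_) (subst (_ ∈_) (addR≡map g hs) p)

addLA≡map : ∀ gs h → addLA gs h ≡ map (_⊕ h) gs
addLA≡map []       h = refl
addLA≡map (g ∷ gs) h = cong (g ⊕ h ∷_) (addLA≡map gs h)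

addRA≡map : ∀ g hs → addRA g hs ≡ map (g ⊕_) hs
addRA≡map g []       = refl
addRA≡map g (h ∷ hs) = cong (g ⊕ h ∷_) (addRA≡map g hs)

ιs≡map : ∀ gs → ιs gs ≡ map ι gs
ιs≡map []       = refl
ιs≡map (g ∷ gs) = cong (ι g ∷_) (ιs≡map gs)

aLeftOpts-⊕ : ∀ G H → aLeftOpts (G ⊕ H) ≡ map (_⊕ H) (aLeftOpts G) ++ map (G ⊕_) (aLeftOpts H)
aLeftOpts-⊕ G@(node _ _ gl _) H@(node _ _ hl _) = cong₂ _++_ (addLA≡map gl H) (addRA≡map G hl)

aRightOpts-⊕ : ∀ G H → aRightOpts (G ⊕ H) ≡ map (_⊕ H) (aRightOpts G) ++ map (G ⊕_) (aRightOpts H)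
aRightOpts-⊕ G@(node _ _ _ gr) H@(node _ _ _ hr) = cong₂ _++_ (addLA≡map gr H) (addRA≡map G hr)

∈-aLeftOpts-⊕⁻ : ∀ G H {y} → y ∈ aLeftOpts (G ⊕ H) →
                 (∃[ g ] g ∈ aLeftOpts G × y ≡ g ⊕ H) Sum.⊎ (∃[ h ] h ∈ aLeftOpts H × y ≡ G ⊕ h)
∈-aLeftOpts-⊕⁻ G H p =
  Sum.map (∈-map⁻ _) (∈-map⁻ _) (∈-++⁻ _ (subst (_ ∈_) (aLeftOpts-⊕ G H) p))

∈-aRightOpts-⊕⁺ˡ : ∀ G H {g} → g ∈ aRightOpts G → g ⊕ H ∈ aRightOpts (G ⊕ H)
∈-aRightOpts-⊕⁺ˡ G H p = subst (_ ∈_) (sym (aRightOpts-⊕ G H)) (∈-++⁺ˡ (∈-map⁺ _ p))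

∈-aRightOpts-⊕⁺ʳ : ∀ G H {h} → h ∈ aRightOpts H → G ⊕ h ∈ aRightOpts (G ⊕ H)
∈-aRightOpts-⊕⁺ʳ G H p = subst (_ ∈_) (sym (aRightOpts-⊕ G H)) (∈-++⁺ʳ _ (∈-map⁺ _ p))

∈-aLeftOpts-ι⁻ : ∀ X {w} → w ∈ aLeftOpts (ι X) → ∃[ x ] x ∈ leftOpts X × w ≡ ι x
∈-aLeftOpts-ι⁻ ⟨ l ∣ _ ⟩ p = ∈-map⁻ ι (subst (_ ∈_) (ιs≡map l) p)

∈-aRightOpts-ι⁺ : ∀ X {x} → x ∈ rightOpts X → ι x ∈ aRightOpts (ι X)
∈-aRightOpts-ι⁺ ⟨ _ ∣ r ⟩ p = subst (_ ∈_) (sym (ιs≡map r)) (∈-map⁺ ι p)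

someNotLWinsA-∈ : ∀ {y ys} → y ∈ ys → lWinsA y ≡ false → someNotLWinsA ys ≡ true
someNotLWinsA-∈ (here refl) e rewrite e = refl
someNotLWinsA-∈ {ys = y ∷ _} (there p) e rewrite someNotLWinsA-∈ p e = ∨-zeroʳ (not (lWinsA y))

someNotRWinsA-none : ∀ {ys} → (∀ {y} → y ∈ ys → rWinsA y ≡ true) → someNotRWinsA ys ≡ false
someNotRWinsA-none {[]}    _   = refl
someNotRWinsA-none {y ∷ _} all rewrite all (here refl) = someNotRWinsA-none (all ∘ there)

rWinsA-byMove : ∀ G {y} → y ∈ aRightOpts G → lWinsA y ≡ false → rWinsA G ≡ true
rWinsA-byMove (node _ rt _ (_ ∷ _)) p e rewrite someNotLWinsA-∈ p e = ∨-zeroʳ rt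

lWinsA-blocked : ∀ G → ¬ LeftEndLike G → (∀ {y} → y ∈ aLeftOpts G → rWinsA y ≡ true) →
                 lWinsA G ≡ false
lWinsA-blocked (node _ _ [] _)          ¬end _   = ⊥-elim (¬end (inj₁ refl))
lWinsA-blocked (node true _ (_ ∷ _) _)  ¬end _   = ⊥-elim (¬end (inj₂ refl))
lWinsA-blocked (node false _ (_ ∷ _) _) _    all = someNotRWinsA-none all

oLA≡Left⇒lWinsA : ∀ G → oLA G ≡ Left → lWinsA G ≡ true
oLA≡Left⇒lWinsA G with lWinsA G
... | true = λ _ → refl

lWinsA⇒oLA≡Left : ∀ G → lWinsA G ≡ true → oLA G ≡ Left
lWinsA⇒oLA≡Left G = cong (if_then Left else Right)

oRA≡Right⇒rWinsA : ∀ G → oRA G ≡ Right → rWinsA G ≡ true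
oRA≡Right⇒rWinsA G with rWinsA G
... | true = λ _ → refl

LeftEndLike? : ∀ G → Dec (LeftEndLike G)
LeftEndLike? (node _ _ [] _)          = yes (inj₁ refl)
LeftEndLike? (node true _ (_ ∷ _) _)  = yes (inj₂ refl)
LeftEndLike? (node false _ (_ ∷ _) _) = no [ (λ ()) , (λ ()) ]

⊕-¬LeftEndLikeˡ : ∀ G H → ¬ LeftEndLike G → ¬ LeftEndLike (G ⊕ H)
⊕-¬LeftEndLikeˡ (node _ _ [] _)          _               ¬end = ⊥-elim (¬end (inj₁ refl))
⊕-¬LeftEndLikeˡ (node true _ (_ ∷ _) _)  _               ¬end = ⊥-elim (¬end (inj₂ refl))
⊕-¬LeftEndLikeˡ (node false _ (_ ∷ _) _) (node _ _ _ _) _    = [ (λ ()) , (λ ()) ]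

⊕-¬LeftEndLikeʳ : ∀ G H → ¬ LeftEndLike H → ¬ LeftEndLike (G ⊕ H)
⊕-¬LeftEndLikeʳ _ (node _ _ [] _)         ¬end = ⊥-elim (¬end (inj₁ refl))
⊕-¬LeftEndLikeʳ _ (node true _ (_ ∷ _) _) ¬end = ⊥-elim (¬end (inj₂ refl))
⊕-¬LeftEndLikeʳ (node lt _ gl _) (node false _ (_ ∷ _) _) _ (inj₁ e)
  with () ← ++-conicalʳ (addLA gl _) _ e
⊕-¬LeftEndLikeʳ (node lt _ gl _) (node false _ (_ ∷ _) _) _ (inj₂ e)
  with () ← trans (sym (cong (_∧ (lt ∨ false)) (∧-zeroʳ (nullB gl ∨ lt)))) e

ι-¬LeftEndLike : ∀ X {x} → x ∈ leftOpts X → ¬ LeftEndLike (ι X)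
ι-¬LeftEndLike ⟨ _ ∷ _ ∣ _ ⟩ _ = [ (λ ()) , (λ ()) ]

LeftEndLike-ι : ∀ X → LeftEndLike (ι X) → LeftEnd X
LeftEndLike-ι ⟨ [] ∣ _ ⟩    _        = refl
LeftEndLike-ι ⟨ _ ∷ _ ∣ _ ⟩ (inj₁ ())
LeftEndLike-ι ⟨ _ ∷ _ ∣ _ ⟩ (inj₂ ())

RightEndLike-ι : ∀ X → RightEndLike (ι X) → RightEnd X
RightEndLike-ι ⟨ _ ∣ [] ⟩    _        = refl
RightEndLike-ι ⟨ _ ∣ _ ∷ _ ⟩ (inj₁ ())
RightEndLike-ι ⟨ _ ∣ _ ∷ _ ⟩ (inj₂ ())

node-cong : ∀ {lt′ rt′ l l′ r r′} → lt ≡ lt′ → rt ≡ rt′ → l ≡ l′ → r ≡ r′ →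
            node lt rt l r ≡ node lt′ rt′ l′ r′
node-cong refl refl refl refl = refl

ιs-++ : ∀ xs ys → ιs (xs ++ ys) ≡ ιs xs ++ ιs ys
ιs-++ []       ys = refl
ιs-++ (x ∷ xs) ys = cong (ι x ∷_) (ιs-++ xs ys)

mutual
  ι-+ : ∀ A B → ι (A + B) ≡ ι A ⊕ ι B
  ι-+ A@(⟨ al ∣ ar ⟩) B@(⟨ bl ∣ br ⟩) =
    node-cong (sym (∧-zeroʳ _)) (sym (∧-zeroʳ _))
      (trans (ιs-++ (addL al B) (addR A bl)) (cong₂ _++_ (ιs-addL al B) (ιs-addR A bl)))
      (trans (ιs-++ (addL ar B) (addR A br)) (cong₂ _++_ (ιs-addL ar B) (ιs-addR A br)))

  ιs-addL : ∀ as B → ιs (addL as B) ≡ addLA (ιs as) (ι B)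
  ιs-addL []       B = refl
  ιs-addL (a ∷ as) B = cong₂ _∷_ (ι-+ a B) (ιs-addL as B)

  ιs-addR : ∀ A bs → ιs (addR A bs) ≡ addRA (ι A) (ιs bs)
  ιs-addR A []       = refl
  ιs-addR A (b ∷ bs) = cong₂ _∷_ (ι-+ A b) (ιs-addR A bs)

mutual
  lWinsA-ι : ∀ A → lWinsA (ι A) ≡ lWins A
  lWinsA-ι ⟨ [] ∣ _ ⟩     = refl
  lWinsA-ι ⟨ g ∷ gs ∣ _ ⟩ = someNotRWinsA-ιs (g ∷ gs)

  rWinsA-ι : ∀ A → rWinsA (ι A) ≡ rWins A
  rWinsA-ι ⟨ _ ∣ [] ⟩     = refl
  rWinsA-ι ⟨ _ ∣ g ∷ gs ⟩ = someNotLWinsA-ιs (g ∷ gs)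

  someNotRWinsA-ιs : ∀ xs → someNotRWinsA (ιs xs) ≡ someNotRWins xs
  someNotRWinsA-ιs []       = refl
  someNotRWinsA-ιs (x ∷ xs) = cong₂ (λ p q → not p ∨ q) (rWinsA-ι x) (someNotRWinsA-ιs xs)

  someNotLWinsA-ιs : ∀ xs → someNotLWinsA (ιs xs) ≡ someNotLWins xs
  someNotLWinsA-ιs []       = refl
  someNotLWinsA-ιs (x ∷ xs) = cong₂ (λ p q → not p ∨ q) (lWinsA-ι x) (someNotLWinsA-ιs xs)

mutual
  conjA : AGame → AGame
  conjA (node lt rt l r) = node rt lt (conjAs r) (conjAs l)

  conjAs : List AGame → List AGame
  conjAs []       = []
  conjAs (g ∷ gs) = conjA g ∷ conjAs gs

conjAs-++ : ∀ xs ys → conjAs (xs ++ ys) ≡ conjAs xs ++ conjAs ys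
conjAs-++ []       ys = refl
conjAs-++ (x ∷ xs) ys = cong (conjA x ∷_) (conjAs-++ xs ys)

nullB-conjAs : ∀ xs → nullB (conjAs xs) ≡ nullB xs
nullB-conjAs []      = refl
nullB-conjAs (_ ∷ _) = refl

leftEndLikeB-conjA : ∀ G → leftEndLikeB (conjA G) ≡ rightEndLikeB G
leftEndLikeB-conjA (node _ rt _ r) = cong (_∨ rt) (nullB-conjAs r)

rightEndLikeB-conjA : ∀ G → rightEndLikeB (conjA G) ≡ leftEndLikeB G
rightEndLikeB-conjA (node lt _ l _) = cong (_∨ lt) (nullB-conjAs l)

LeftEndLike-conjA : LeftEndLike (conjA G) → RightEndLike G
LeftEndLike-conjA {node _ _ _ []}      _         = inj₁ refl
LeftEndLike-conjA {node _ _ _ (_ ∷ _)} (inj₁ ())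
LeftEndLike-conjA {node _ _ _ (_ ∷ _)} (inj₂ e)  = inj₂ e

mutual
  conjA-⊕ : ∀ G H → conjA (G ⊕ H) ≡ conjA G ⊕ conjA H
  conjA-⊕ G@(node lt rt gl gr) H@(node lt′ rt′ hl hr) =
    node-cong
      (sym (cong₂ (λ p q → (p ∧ q) ∧ (rt ∨ rt′)) (leftEndLikeB-conjA G) (leftEndLikeB-conjA H)))
      (sym (cong₂ (λ p q → (p ∧ q) ∧ (lt ∨ lt′)) (rightEndLikeB-conjA G) (rightEndLikeB-conjA H)))
      (trans (conjAs-++ (addLA gr H) (addRA G hr))
             (cong₂ _++_ (conjAs-addLA gr H) (conjAs-addRA G hr)))
      (trans (conjAs-++ (addLA gl H) (addRA G hl))
             (cong₂ _++_ (conjAs-addLA gl H) (conjAs-addRA G hl)))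

  conjAs-addLA : ∀ gs H → conjAs (addLA gs H) ≡ addLA (conjAs gs) (conjA H)
  conjAs-addLA []       H = refl
  conjAs-addLA (g ∷ gs) H = cong₂ _∷_ (conjA-⊕ g H) (conjAs-addLA gs H)

  conjAs-addRA : ∀ G hs → conjAs (addRA G hs) ≡ addRA (conjA G) (conjAs hs)
  conjAs-addRA G []       = refl
  conjAs-addRA G (h ∷ hs) = cong₂ _∷_ (conjA-⊕ G h) (conjAs-addRA G hs)

mutual
  lWinsA-conjA : ∀ G → lWinsA (conjA G) ≡ rWinsA G
  lWinsA-conjA (node _ _ _ [])        = refl
  lWinsA-conjA (node _ rt _ (g ∷ gs)) = cong (rt ∨_) (someNotRWinsA-conjAs (g ∷ gs))

  rWinsA-conjA : ∀ G → rWinsA (conjA G) ≡ lWinsA G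
  rWinsA-conjA (node _ _ [] _)        = refl
  rWinsA-conjA (node lt _ (g ∷ gs) _) = cong (lt ∨_) (someNotLWinsA-conjAs (g ∷ gs))

  someNotRWinsA-conjAs : ∀ gs → someNotRWinsA (conjAs gs) ≡ someNotLWinsA gs
  someNotRWinsA-conjAs []       = refl
  someNotRWinsA-conjAs (g ∷ gs) =
    cong₂ (λ p q → not p ∨ q) (rWinsA-conjA g) (someNotRWinsA-conjAs gs)

  someNotLWinsA-conjAs : ∀ gs → someNotLWinsA (conjAs gs) ≡ someNotRWinsA gs
  someNotLWinsA-conjAs []       = refl
  someNotLWinsA-conjAs (g ∷ gs) =
    cong₂ (λ p q → not p ∨ q) (lWinsA-conjA g) (someNotLWinsA-conjAs gs)

mutual
  conjA-ι-conj : ∀ X → conjA (ι (conj X)) ≡ ι X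
  conjA-ι-conj ⟨ l ∣ r ⟩ = cong₂ (node false false) (conjAs-ιs-conjs l) (conjAs-ιs-conjs r)

  conjAs-ιs-conjs : ∀ xs → conjAs (ιs (conjs xs)) ≡ ιs xs
  conjAs-ιs-conjs []       = refl
  conjAs-ιs-conjs (x ∷ xs) = cong₂ _∷_ (conjA-ι-conj x) (conjAs-ιs-conjs xs)

LeftEnd-conj : ∀ X → LeftEnd X → RightEnd (conj X)
LeftEnd-conj ⟨ _ ∣ _ ⟩ = cong conjs

data Height≤ : ℕ → AGame → Set where
  height≤ : ∀ {l r} → (∀ {x} → x ∈ l → Height≤ n x) → (∀ {x} → x ∈ r → Height≤ n x) →
            Height≤ (suc n) (node lt rt l r)

Height≤-mono : m ≤ n → Height≤ m G → Height≤ n G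
Height≤-mono (s≤s m≤n) (height≤ hl hr) = height≤ (Height≤-mono m≤n ∘ hl) (Height≤-mono m≤n ∘ hr)

mutual
  height : ∀ G → ∃[ n ] Height≤ (suc n) G
  height (node _ _ l r) with heights l | heights r
  ... | m , hl | n , hr =
    m ⊔ n , height≤ (Height≤-mono (m≤m⊔n m n) ∘ hl) (Height≤-mono (m≤n⊔m m n) ∘ hr)

  heights : ∀ gs → ∃[ n ] (∀ {x} → x ∈ gs → Height≤ n x)
  heights []       = 0 , λ ()
  heights (g ∷ gs) with height g | heights gs
  ... | m , hg | n , hgs = suc m ⊔ n , λ where
    (here refl) → Height≤-mono (m≤m⊔n (suc m) n) hg
    (there p)   → Height≤-mono (m≤n⊔m (suc m) n) (hgs p)

-- a counts the copies of Y = {·|2} in Z and b the Left moves left in its 2s and 1s; the 0s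
-- appear when Left plays 1 to 0.
data Reserve : ℕ → ℕ → Game → Set where
  ∅  : Reserve 0 0 zeroG
  +Y : Reserve a b Z → Reserve (suc a) b (noneBar2 + Z)
  +2 : Reserve a b Z → Reserve a (2 +ℕ b) (twoG + Z)
  +1 : Reserve a b Z → Reserve a (suc b) (oneG + Z)
  +0 : Reserve a b Z → Reserve a b (zeroG + Z)

Reserve-leftOpt⁻ : ∀ {x} → Reserve a b Z → x ∈ leftOpts Z → ∃[ b′ ] b ≡ suc b′ × Reserve a b′ x
Reserve-leftOpt⁻ (+Y {Z = ⟨ _ ∣ _ ⟩} z) p with ∈-addR⁻ p
... | _ , q , refl with Reserve-leftOpt⁻ z q
...   | _ , refl , z′ = _ , refl , +Y z′
Reserve-leftOpt⁻ (+2 {Z = ⟨ _ ∣ _ ⟩} z) (here refl) = _ , refl , +1 z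
Reserve-leftOpt⁻ (+2 {Z = ⟨ _ ∣ _ ⟩} z) (there p) with ∈-addR⁻ p
... | _ , q , refl with Reserve-leftOpt⁻ z q
...   | _ , refl , z′ = _ , refl , +2 z′
Reserve-leftOpt⁻ (+1 {Z = ⟨ _ ∣ _ ⟩} z) (here refl) = _ , refl , +0 z
Reserve-leftOpt⁻ (+1 {Z = ⟨ _ ∣ _ ⟩} z) (there p) with ∈-addR⁻ p
... | _ , q , refl with Reserve-leftOpt⁻ z q
...   | _ , refl , z′ = _ , refl , +1 z′
Reserve-leftOpt⁻ (+0 {Z = ⟨ _ ∣ _ ⟩} z) p with ∈-addR⁻ p
... | _ , q , refl with Reserve-leftOpt⁻ z q
...   | _ , refl , z′ = _ , refl , +0 z′

Reserve-leftOpt⁺ : Reserve a (suc b) Z → ∃[ x ] x ∈ leftOpts Z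
Reserve-leftOpt⁺ (+Y {Z = ⟨ _ ∣ _ ⟩} z) with Reserve-leftOpt⁺ z
... | _ , p = _ , ∈-addR⁺ p
Reserve-leftOpt⁺ (+2 {Z = ⟨ _ ∣ _ ⟩} z) = _ , here refl
Reserve-leftOpt⁺ (+1 {Z = ⟨ _ ∣ _ ⟩} z) = _ , here refl
Reserve-leftOpt⁺ (+0 {Z = ⟨ _ ∣ _ ⟩} z) with Reserve-leftOpt⁺ z
... | _ , p = _ , ∈-addR⁺ p

Reserve-leftEnd : Reserve a 0 Z → LeftEnd Z
Reserve-leftEnd {Z = ⟨ [] ∣ _ ⟩}    _ = refl
Reserve-leftEnd {Z = ⟨ _ ∷ _ ∣ _ ⟩} z with () ← Reserve-leftOpt⁻ z (here refl)

Reserve-rightOpt⁺ : Reserve (suc a) b Z → ∃[ x ] x ∈ rightOpts Z × Reserve a (2 +ℕ b) x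
Reserve-rightOpt⁺ (+Y {Z = ⟨ _ ∣ _ ⟩} z) = _ , here refl , +2 z
Reserve-rightOpt⁺ (+2 {Z = ⟨ _ ∣ _ ⟩} z) with Reserve-rightOpt⁺ z
... | _ , p , z′ = _ , ∈-addR⁺ p , +2 z′
Reserve-rightOpt⁺ (+1 {Z = ⟨ _ ∣ _ ⟩} z) with Reserve-rightOpt⁺ z
... | _ , p , z′ = _ , ∈-addR⁺ p , +1 z′
Reserve-rightOpt⁺ (+0 {Z = ⟨ _ ∣ _ ⟩} z) with Reserve-rightOpt⁺ z
... | _ , p , z′ = _ , ∈-addR⁺ p , +0 z′

Reserve-rightEnd : Reserve 0 b Z → RightEnd Z
Reserve-rightEnd ∅                      = refl
Reserve-rightEnd (+2 {Z = ⟨ _ ∣ _ ⟩} z) = cong (addR twoG) (Reserve-rightEnd z)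
Reserve-rightEnd (+1 {Z = ⟨ _ ∣ _ ⟩} z) = cong (addR oneG) (Reserve-rightEnd z)
Reserve-rightEnd (+0 {Z = ⟨ _ ∣ _ ⟩} z) = cong (addR zeroG) (Reserve-rightEnd z)

mutual
  rightWins-vs-Reserve : Height≤ n H → Reserve a b Z → n ≤ a +ℕ b → rWinsA (H ⊕ ι Z) ≡ true
  rightWins-vs-Reserve {n} {H} {suc a} {b} {Z} hH z n≤ with Reserve-rightOpt⁺ z
  ... | _ , p , z′ =
    rWinsA-byMove (H ⊕ ι Z) (∈-aRightOpts-⊕⁺ʳ H (ι Z) (∈-aRightOpts-ι⁺ Z p))
                  (leftLoses-vs-Reserve hH z′ (subst (n ≤_) (sym (+-suc a b)) n≤))
  rightWins-vs-Reserve {H = node _ _ _ []} {zero} {Z = ⟨ _ ∣ _ ⟩} _ z _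
    with refl ← Reserve-rightEnd z = refl
  rightWins-vs-Reserve {H = H@(node _ _ _ (_ ∷ _))} {zero} {Z = Z} (height≤ _ hR) z (s≤s n≤b) =
    rWinsA-byMove (H ⊕ ι Z) (∈-aRightOpts-⊕⁺ˡ H (ι Z) (here refl))
                  (leftLoses-vs-Reserve (hR (here refl)) z n≤b)

  leftLoses-vs-Reserve : Height≤ n H → Reserve a (suc b) Z → n ≤ a +ℕ b → lWinsA (H ⊕ ι Z) ≡ false
  leftLoses-vs-Reserve {suc n} {H} {a} {b} {Z} hH@(height≤ hL _) z n<a+b =
    lWinsA-blocked (H ⊕ ι Z)
      (⊕-¬LeftEndLikeʳ H (ι Z) (ι-¬LeftEndLike Z (proj₂ (Reserve-leftOpt⁺ z)))) answer
    where
    answer : ∀ {y} → y ∈ aLeftOpts (H ⊕ ι Z) → rWinsA y ≡ true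
    answer y∈ with ∈-aLeftOpts-⊕⁻ H (ι Z) y∈
    ... | inj₁ (_ , x∈ , refl) =
      rightWins-vs-Reserve (hL x∈) z (≤-trans (n≤1+n n) (≤-trans n<a+b (+-monoʳ-≤ a (n≤1+n b))))
    ... | inj₂ (_ , w∈ , refl) with ∈-aLeftOpts-ι⁻ Z w∈
    ...   | _ , x∈ , refl with Reserve-leftOpt⁻ z x∈
    ...     | _ , refl , z′ = rightWins-vs-Reserve hH z′ n<a+b

multiple : ℕ → Game → Game
multiple zero    _ = zeroG
multiple (suc m) X = X + multiple m X

Reserve-multiple : ∀ m → Reserve m 0 (multiple m noneBar2)
Reserve-multiple zero    = ∅
Reserve-multiple (suc m) = +Y (Reserve-multiple m)

leftLoses-vs-multiple : Height≤ (suc m) G → ¬ LeftEndLike G →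
                        lWinsA (G ⊕ ι (multiple m noneBar2)) ≡ false
leftLoses-vs-multiple {m} {G} (height≤ hL _) ¬end =
  lWinsA-blocked (G ⊕ ι Yᵐ) (⊕-¬LeftEndLikeˡ G (ι Yᵐ) ¬end) answer
  where
  Yᵐ : Game
  Yᵐ = multiple m noneBar2

  answer : ∀ {y} → y ∈ aLeftOpts (G ⊕ ι Yᵐ) → rWinsA y ≡ true
  answer y∈ with ∈-aLeftOpts-⊕⁻ G (ι Yᵐ) y∈
  ... | inj₁ (_ , x∈ , refl) = rightWins-vs-Reserve (hL x∈) (Reserve-multiple m) (m≤m+n m 0)
  ... | inj₂ (_ , w∈ , refl) with ∈-aLeftOpts-ι⁻ Yᵐ w∈
  ...   | _ , x∈ , _ with () ← Reserve-leftOpt⁻ (Reserve-multiple m) x∈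

LeftStrong⇒LeftEndLike : (∀ m → U (multiple m noneBar2)) → LeftStrong U G → LeftEndLike G
LeftStrong⇒LeftEndLike {G = G} multiples∈U strong with LeftEndLike? G | height G
... | yes end | _      = end
... | no ¬end | m , hG = contradiction (trans (sym leftWins) (leftLoses-vs-multiple hG ¬end)) λ ()
  where
  leftWins : lWinsA (G ⊕ ι (multiple m noneBar2)) ≡ true
  leftWins = oLA≡Left⇒lWinsA (G ⊕ ι (multiple m noneBar2))
               (strong _ (multiples∈U m) (Reserve-leftEnd (Reserve-multiple m)))

RightStrong⇒LeftStrong-conjA : (∀ {X} → U X → U (conj X)) → RightStrong U G → LeftStrong U (conjA G)
RightStrong⇒LeftStrong-conjA {G = G} conj∈U strong X X∈U end =
  lWinsA⇒oLA≡Left (conjA G ⊕ ι X) (begin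
    lWinsA (conjA G ⊕ ι X)                 ≡⟨ cong (λ K → lWinsA (conjA G ⊕ K)) (conjA-ι-conj X) ⟨
    lWinsA (conjA G ⊕ conjA (ι (conj X)))  ≡⟨ cong lWinsA (conjA-⊕ G (ι (conj X))) ⟨
    lWinsA (conjA (G ⊕ ι (conj X)))        ≡⟨ lWinsA-conjA (G ⊕ ι (conj X)) ⟩
    rWinsA (G ⊕ ι (conj X))                ≡⟨ oRA≡Right⇒rWinsA (G ⊕ ι (conj X)) strong-conj ⟩
    true                                   ∎)
  where
  open ≡-Reasoning
  strong-conj : oRA (G ⊕ ι (conj X)) ≡ Right
  strong-conj = strong (conj X) (conj∈U X∈U) (LeftEnd-conj X end)

RightStrong⇒RightEndLike : (∀ {X} → U X → U (conj X)) → (∀ m → U (multiple m noneBar2)) →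
                           RightStrong U G → RightEndLike G
RightStrong⇒RightEndLike {G = G} conj∈U multiples∈U =
  LeftEndLike-conjA ∘ LeftStrong⇒LeftEndLike multiples∈U
                    ∘ RightStrong⇒LeftStrong-conjA {G = G} conj∈U

LeftEndLike⇒LeftStrong : LeftEndLike G → LeftStrong U G
LeftEndLike⇒LeftStrong {node _ _ [] _}          _        ⟨ _ ∣ _ ⟩ _ refl = refl
LeftEndLike⇒LeftStrong {node true _ (_ ∷ _) _}  _        ⟨ _ ∣ _ ⟩ _ refl = refl
LeftEndLike⇒LeftStrong {node false _ (_ ∷ _) _} (inj₁ ())
LeftEndLike⇒LeftStrong {node false _ (_ ∷ _) _} (inj₂ ())

RightEndLike⇒RightStrong : RightEndLike G → RightStrong U G
RightEndLike⇒RightStrong {node _ _ _ []}          _        ⟨ _ ∣ _ ⟩ _ refl = refl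
RightEndLike⇒RightStrong {node _ true _ (_ ∷ _)}  _        ⟨ _ ∣ _ ⟩ _ refl = refl
RightEndLike⇒RightStrong {node _ false _ (_ ∷ _)} (inj₁ ())
RightEndLike⇒RightStrong {node _ false _ (_ ∷ _)} (inj₂ ())

module _ (isU : IsUniverse U) where
  open IsUniverse isU

  zeroG∈ : U X → U zeroG
  zeroG∈ {⟨ [] ∣ [] ⟩}    X∈U = X∈U
  zeroG∈ {⟨ _ ∷ _ ∣ _ ⟩}  X∈U = zeroG∈ (leftOpt-closed X∈U (here refl))
  zeroG∈ {⟨ [] ∣ _ ∷ _ ⟩} X∈U = zeroG∈ (rightOpt-closed X∈U (here refl))

  multiple∈ : U X → ∀ m → U (multiple m X)
  multiple∈ X∈U zero    = zeroG∈ X∈U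
  multiple∈ X∈U (suc m) = sum-closed X∈U (multiple∈ X∈U m)

  weak : U noneBar2 → Weak U
  weak Y∈U G = mk⇔ (LeftStrong⇒LeftEndLike (multiple∈ Y∈U)) LeftEndLike⇒LeftStrong
             , mk⇔ (RightStrong⇒RightEndLike conj-closed (multiple∈ Y∈U)) RightEndLike⇒RightStrong

≤O-leftWins : ∀ {p q r s} → outcomeOf p q ≤O outcomeOf r s → p ≡ Left → r ≡ Left
≤O-leftWins {r = Left} _ _ = refl
≤O-leftWins {Left} {Left}  {Right} {Left}  () refl
≤O-leftWins {Left} {Left}  {Right} {Right} () refl
≤O-leftWins {Left} {Right} {Right} {Left}  () refl
≤O-leftWins {Left} {Right} {Right} {Right} () refl

≤O-rightWins : ∀ {p q r s} → outcomeOf p q ≤O outcomeOf r s → s ≡ Right → q ≡ Right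
≤O-rightWins {q = Right} _ _ = refl
≤O-rightWins {Left}  {Left} {Left}  {Right} () refl
≤O-rightWins {Left}  {Left} {Right} {Right} () refl
≤O-rightWins {Right} {Left} {Left}  {Right} () refl
≤O-rightWins {Right} {Left} {Right} {Right} () refl

≥zeroG⇒LeftStrong : ∀ K → K ≥[ U ] zeroG → LeftStrong U (ι K)
≥zeroG⇒LeftStrong K K≥0 X@(⟨ _ ∣ _ ⟩) X∈U refl = begin
  oLA (ι K ⊕ ι X)  ≡⟨ cong oLA (ι-+ K X) ⟨
  oLA (ι (K + X))  ≡⟨ cong (if_then Left else Right) (lWinsA-ι (K + X)) ⟩
  oL (K + X)       ≡⟨ ≤O-leftWins (K≥0 X X∈U) refl ⟩
  Left             ∎
  where open ≡-Reasoning

≤zeroG⇒RightStrong : ∀ K → zeroG ≥[ U ] K → RightStrong U (ι K)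
≤zeroG⇒RightStrong K K≤0 X@(⟨ _ ∣ _ ⟩) X∈U refl = begin
  oRA (ι K ⊕ ι X)  ≡⟨ cong oRA (ι-+ K X) ⟨
  oRA (ι (K + X))  ≡⟨ cong (if_then Right else Left) (rWinsA-ι (K + X)) ⟩
  oR (K + X)       ≡⟨ ≤O-rightWins (K≤0 X X∈U) refl ⟩
  Right            ∎
  where open ≡-Reasoning

Weak⇒≡[]zeroG⇒≡zeroG : Weak U → X ≡[ U ] zeroG → X ≡ zeroG
Weak⇒≡[]zeroG⇒≡zeroG {X = X@(⟨ _ ∣ _ ⟩)} weakU (X≥0 , X≤0)
  with refl ← LeftEndLike-ι X (Equivalence.to (proj₁ (weakU (ι X))) (≥zeroG⇒LeftStrong X X≥0))
     | refl ← RightEndLike-ι X (Equivalence.to (proj₂ (weakU (ι X))) (≤zeroG⇒RightStrong X X≤0))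
  = refl

+≡zeroG⇒≡zeroG : ∀ X Z → X + Z ≡ zeroG → X ≡ zeroG
+≡zeroG⇒≡zeroG ⟨ [] ∣ [] ⟩    _         _  = refl
+≡zeroG⇒≡zeroG ⟨ _ ∷ _ ∣ _ ⟩  ⟨ _ ∣ _ ⟩ ()
+≡zeroG⇒≡zeroG ⟨ [] ∣ _ ∷ _ ⟩ ⟨ _ ∣ _ ⟩ ()

Weak⇒Reduced : Weak U → Reduced U
Weak⇒Reduced weakU X _ (Z , _ , X+Z≡0)
  with refl ← +≡zeroG⇒≡zeroG X Z (Weak⇒≡[]zeroG⇒≡zeroG weakU X+Z≡0)
  = (λ _ _ → refl≤) , (λ _ _ → refl≤)

corollary5p11 : (U : Game → Set) → IsUniverse U → U noneBar2 → Weak U × Reduced U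
corollary5p11 U isU Y∈U = weak isU Y∈U , Weak⇒Reduced (weak isU Y∈U)
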